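{- Let $m,n,s,t$ be positive integers and let $H$ be a Heffter array $H(m,n;s,t)$. If there exist compatible orderings $\omega_r$ and $\omega_c$ for $H$, then one of the following holds: (1) $m$, $n$, $s$ and $t$ are all odd; (2) $m$ is odd, $n$ is even and $s$ is even; or (3) $m$ is even, $n$ is odd and $t$ is even.
   Context: A Heffter array $H(m,n;s,t)$ is an $m\times n$ partially filled array of integers such that each row contains exactly $s$ filled cells and each column contains exactly $t$ filled cells (so $ms=nt$), the entries of every row and every column sum to $0$ in $\mathbb{Z}_{2ms+1}$, and for each integer $1\le x\le ms$ either $x$ or $-x$ appears in the array (in particular all entries are distinct). An ordering of the rows is a choice, for each row, of a cyclic ordering of the entries of that row, viewed as a cycle permutation of those entries; $\omega_r$ denotes the composition of these cycles over all rows, a permutation of the set of all entries. Similarly an ordering of the columns gives $\omega_c$, the composition of the chosen cycles over all columns. The orderings $\omega_r$ and $\omega_c$ are called compatible if $\omega_r\circ\omega_c$ is a single cycle of length $ms$ on the set of entries. -}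

module Defs where

open import Data.Nat using (ℕ; zero; suc; _+_; _*_; _≤_)
open import Data.Integer as ℤ using (ℤ; +_)
open import Data.Integer.Divisibility as ℤD using ()
open import Data.Fin using (Fin)
open import Data.Maybe using (Maybe; just; nothing; is-just; fromMaybe)
open import Data.Bool using (Bool; true; false; T; if_then_else_)
open import Data.List using (List; map; allFin)
open import Data.Nat.ListAction using (sum)
open import Data.Product using (Σ; ∃; _×_; _,_; proj₁; proj₂)
open import Data.Sum using (_⊎_)
open import Function.Definitions using (Bijective)
open import Relation.Binary.PropositionalEquality using (_≡_)

-- A partially filled m × n array of integers: nothing = empty cell.
PArray : ℕ → ℕ → Set
PArray m n = Fin m → Fin n → Maybe ℤ

rowCount : ∀ {m n} → PArray m n → Fin m → ℕ
rowCount {n = n} A i = sum (map (λ j → if is-just (A i j) then 1 else 0) (allFin n))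

colCount : ∀ {m n} → PArray m n → Fin n → ℕ
colCount {m = m} A j = sum (map (λ i → if is-just (A i j) then 1 else 0) (allFin m))

rowSum : ∀ {m n} → PArray m n → Fin m → ℤ
rowSum {n = n} A i = Data.List.foldr ℤ._+_ (+ 0) (map (λ j → fromMaybe (+ 0) (A i j)) (allFin n))

colSum : ∀ {m n} → PArray m n → Fin n → ℤ
colSum {m = m} A j = Data.List.foldr ℤ._+_ (+ 0) (map (λ i → fromMaybe (+ 0) (A i j)) (allFin m))

record IsHeffter (m n s t : ℕ) (H : PArray m n) : Set where
  field
    rowFilled : ∀ i → rowCount H i ≡ s
    colFilled : ∀ j → colCount H j ≡ t
    rowZero   : ∀ i → (+ (2 * (m * s) + 1)) ℤD.∣ rowSum H i
    colZero   : ∀ j → (+ (2 * (m * s) + 1)) ℤD.∣ colSum H j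
    covers    : ∀ (x : ℕ) → 1 ≤ x → x ≤ m * s →
                Σ (Fin m) λ i → Σ (Fin n) λ j →
                  (H i j ≡ just (+ x)) ⊎ (H i j ≡ just (ℤ.- (+ x)))

-- The filled cells of H (= the entries of H, which are pairwise distinct).
Cell : ∀ {m n} → PArray m n → Set
Cell {m} {n} H = Σ (Fin m × Fin n) λ p → T (is-just (H (proj₁ p) (proj₂ p)))

rowOf : ∀ {m n} {H : PArray m n} → Cell H → Fin m
rowOf c = proj₁ (proj₁ c)

colOf : ∀ {m n} {H : PArray m n} → Cell H → Fin n
colOf c = proj₂ (proj₁ c)

iter : ∀ {A : Set} → (A → A) → ℕ → A → A
iter f zero    x = x
iter f (suc k) x = f (iter f k x)

-- ω is a permutation of the cells which is the product, over all rows, of a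
-- cycle on the cells of that row (i.e. a cyclic ordering of each row):
-- ω is bijective, maps each row into itself, and acts transitively
-- (as a single cycle) on the cells of each row.
IsRowOrdering : ∀ {m n} (H : PArray m n) → (Cell H → Cell H) → Set
IsRowOrdering H ω =
  Bijective _≡_ _≡_ ω ×
  (∀ c → rowOf {H = H} (ω c) ≡ rowOf {H = H} c) ×
  (∀ c d → rowOf {H = H} c ≡ rowOf {H = H} d → ∃ λ k → iter ω k c ≡ d)

IsColOrdering : ∀ {m n} (H : PArray m n) → (Cell H → Cell H) → Set
IsColOrdering H ω =
  Bijective _≡_ _≡_ ω ×
  (∀ c → colOf {H = H} (ω c) ≡ colOf {H = H} c) ×
  (∀ c d → colOf {H = H} c ≡ colOf {H = H} d → ∃ λ k → iter ω k c ≡ d)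

Compatible : ∀ {m n} (H : PArray m n) → (Cell H → Cell H) → (Cell H → Cell H) → Set
Compatible H ωr ωc = ∀ c d → ∃ λ k → iter (λ x → ωr (ωc x)) k c ≡ d

module Submission where

-- Let N = m s = n t be the number of filled cells. The row ordering ωr is a
-- permutation of the cells with exactly m cycles (one per row), ωc one with
-- n cycles, and compatibility says that ωr ∘ ωc is a single cycle. A
-- permutation of N points with k cycles has sign N - k (mod 2) and the sign is
-- multiplicative, so (N - m) + (N - n) ≡ N - 1, i.e. N ≡ m + n + 1 (mod 2);
-- together with N = m s = n t this leaves exactly the three listed cases.

open import Defs
open import Data.Nat using (ℕ; _≤_)
open import Data.Nat.Divisibility using (_∣_)
open import Data.Product using (Σ; _×_)
open import Data.Sum using (_⊎_)
open import Relation.Nullary using (¬_)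

open import Data.Bool using (Bool; true; false; T; if_then_else_)
open import Data.Empty using (⊥-elim)
open import Data.Fin using (Fin; zero; suc; punchIn; punchOut; fromℕ<)
open import Data.Fin.Permutation.Components using (transpose; transpose-inverse)
open import Data.Fin.Properties
  using ( _≟_; suc-injective; punchIn-injective; punchInᵢ≢i; punchIn-punchOut
        ; punchOut-cong; punchOut-injective; punchOut-punchIn; injective⇒≤
        ; 0≢1+n; 0↔⊥; 1↔⊤; +↔⊎; *↔×)
open import Data.List using (map; tabulate)
open import Data.Maybe using (Maybe; just; nothing; is-just)
open import Data.Nat using (zero; suc; _*_; parity)
open import Data.Nat.Divisibility using (divides; _∣0; ∣-refl; ∣m∣n⇒∣m+n)
open import Data.Nat.ListAction using (sum)
open import Data.Nat.Properties using (≤-antisym)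
open import Data.Parity.Base using (Parity; 0ℙ; 1ℙ; _+_)
import Data.Parity.Base as ℙ
open import Data.Parity.Properties
  using (+-*-commutativeRing; +-identityʳ; +-assoc; +-homo-+; *-homo-*; *-zeroʳ)
open import Data.Product using (∃; _,_; map₂)
open import Data.Product.Function.Dependent.Propositional using (Σ-↔)
open import Data.Sum using (inj₁; inj₂)
open import Data.Sum.Function.Propositional using (_⊎-↔_)
open import Function using (_∘_; id)
open import Function.Bundles using (_↔_; Inverse; Injection; mk↔ₛ′)
open import Function.Consequences.Propositional using (surjective⇒strictlySurjective)
open import Function.Construct.Composition using (bijective)
open import Function.Definitions using (Injective; StrictlySurjective; Bijective)
open import Function.Properties.Inverse using (↔-refl; ↔-sym; ↔-trans; ↔⇒↣)
open import Relation.Binary.PropositionalEquality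
  using (_≡_; _≢_; refl; sym; trans; cong; cong₂; subst; module ≡-Reasoning)
open import Relation.Nullary using (Dec; yes; no)
open import Relation.Nullary.Decidable using (dec-true; dec-false)
open import Tactic.RingSolver using (solve-∀)
open import Tactic.RingSolver.Core.AlmostCommutativeRing
  using (AlmostCommutativeRing; fromCommutativeRing)

open ≡-Reasoning

ℙ-ring : AlmostCommutativeRing _ _
ℙ-ring = fromCommutativeRing +-*-commutativeRing isZero
  where
  isZero : ∀ p → Maybe (0ℙ ≡ p)
  isZero 0ℙ = just refl
  isZero 1ℙ = nothing

+-solveˡ : ∀ {x} y {z} → x + y ≡ z → x ≡ y + z
+-solveˡ {x} y refl = cancel x y
  where
  cancel : ∀ x y → x ≡ y + (x + y)
  cancel = solve-∀ ℙ-ring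

finParity : ∀ {n} → Fin n → Parity
finParity zero    = 0ℙ
finParity (suc i) = 1ℙ + finParity i

-- del p x : the position of x in Fin (suc n) after the point p has been
-- deleted; a total version of punchOut (its value at x = p is irrelevant).
del : ∀ {n} → Fin (suc (suc n)) → Fin (suc (suc n)) → Fin (suc n)
del zero    zero    = zero
del zero    (suc x) = x
del (suc p) zero    = zero
del {zero}  (suc p) (suc x) = zero
del {suc n} (suc p) (suc x) = suc (del p x)

del-punchIn : ∀ {n} (p : Fin (suc (suc n))) x → del p (punchIn p x) ≡ x
del-punchIn zero    x       = refl
del-punchIn (suc p) zero    = refl
del-punchIn {suc n} (suc p) (suc x) = cong suc (del-punchIn p x)

punchIn-del : ∀ {n} (p x : Fin (suc (suc n))) → x ≢ p → punchIn p (del p x) ≡ x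
punchIn-del zero    zero    x≢p = ⊥-elim (x≢p refl)
punchIn-del zero    (suc x) x≢p = refl
punchIn-del (suc p) zero    x≢p = refl
punchIn-del {zero}  (suc zero) (suc zero) x≢p = ⊥-elim (x≢p refl)
punchIn-del {suc n} (suc p) (suc x) x≢p = cong suc (punchIn-del p x (x≢p ∘ cong suc))

del-injective : ∀ {n} (p x y : Fin (suc (suc n))) → x ≢ p → y ≢ p → del p x ≡ del p y → x ≡ y
del-injective p x y x≢p y≢p eq = begin
  x                 ≡⟨ sym (punchIn-del p x x≢p) ⟩
  punchIn p (del p x) ≡⟨ cong (punchIn p) eq ⟩
  punchIn p (del p y) ≡⟨ punchIn-del p y y≢p ⟩
  y                 ∎

-- Deleting a from b and b from a: exactly one of the two positions drops
-- by one, so the total parity changes by one.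
del-parity : ∀ {n} (a b : Fin (suc (suc n))) → a ≢ b →
  finParity (del a b) + finParity (del b a) ≡ 1ℙ + finParity a + finParity b
del-parity zero zero a≢b = ⊥-elim (a≢b refl)
del-parity zero (suc b) _ = shift (finParity b)
  where
  shift : ∀ x → x + 0ℙ ≡ 1ℙ + 0ℙ + (1ℙ + x)
  shift = solve-∀ ℙ-ring
del-parity (suc a) zero _ = shift (finParity a)
  where
  shift : ∀ x → 0ℙ + x ≡ 1ℙ + (1ℙ + x) + 0ℙ
  shift = solve-∀ ℙ-ring
del-parity {zero} (suc zero) (suc zero) a≢b = ⊥-elim (a≢b refl)
del-parity {suc n} (suc a) (suc b) a≢b = begin
  (1ℙ + x) + (1ℙ + y)       ≡⟨ flips x y ⟩
  x + y                     ≡⟨ del-parity a b (a≢b ∘ cong suc) ⟩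
  1ℙ + finParity a + finParity b                   ≡⟨ flips' (finParity a) (finParity b) ⟩
  1ℙ + (1ℙ + finParity a) + (1ℙ + finParity b)     ∎
  where
  x = finParity (del a b)
  y = finParity (del b a)
  flips : ∀ x y → (1ℙ + x) + (1ℙ + y) ≡ x + y
  flips = solve-∀ ℙ-ring
  flips' : ∀ a b → 1ℙ + a + b ≡ 1ℙ + (1ℙ + a) + (1ℙ + b)
  flips' = solve-∀ ℙ-ring

del-comm : ∀ {n} (a b x : Fin (suc (suc (suc n)))) → a ≢ b → a ≢ x → b ≢ x →
  del (del b a) (del b x) ≡ del (del a b) (del a x)
del-comm zero    zero    x       a≢b _   _   = ⊥-elim (a≢b refl)
del-comm zero    (suc b) zero    _   a≢x _   = ⊥-elim (a≢x refl)
del-comm (suc a) zero    zero    _   _   b≢x = ⊥-elim (b≢x refl)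
del-comm zero    (suc b) (suc x) _   _   _   = refl
del-comm (suc a) zero    (suc x) _   _   _   = refl
del-comm (suc a) (suc b) zero    _   _   _   = refl
del-comm {zero}  (suc a) (suc b) (suc x) _ _ _ = refl
del-comm {suc n} (suc a) (suc b) (suc x) a≢b a≢x b≢x =
  cong suc (del-comm a b x (a≢b ∘ cong suc) (a≢x ∘ cong suc) (b≢x ∘ cong suc))

minor : ∀ {N} → (Fin (suc N) → Fin (suc N)) → Fin (suc N) → Fin N → Fin N
minor {zero}  σ q ()
minor {suc N} σ q j = del (σ q) (σ (punchIn q j))

-- The sign (as a parity) of a map Fin N → Fin N, defined by expansion along
-- the first point, exactly as the determinant of a permutation matrix.
sgn : ∀ {N} → (Fin N → Fin N) → Parity
sgn {zero}  σ = 0ℙ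
sgn {suc N} σ = sgn (minor σ zero) + finParity (σ zero)

minor-cong : ∀ {N} {σ τ : Fin (suc N) → Fin (suc N)} → (∀ x → σ x ≡ τ x) →
  ∀ q j → minor σ q j ≡ minor τ q j
minor-cong {zero}  σ≗τ q ()
minor-cong {suc N} σ≗τ q j = cong₂ del (σ≗τ q) (σ≗τ _)

sgn-cong : ∀ {N} {σ τ : Fin N → Fin N} → (∀ x → σ x ≡ τ x) → sgn σ ≡ sgn τ
sgn-cong {zero}  σ≗τ = refl
sgn-cong {suc N} σ≗τ = cong₂ _+_ (sgn-cong (minor-cong σ≗τ zero)) (cong finParity (σ≗τ zero))

minor-injective : ∀ {N} (σ : Fin (suc N) → Fin (suc N)) → Injective _≡_ _≡_ σ →
  ∀ q → Injective _≡_ _≡_ (minor σ q)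
minor-injective {zero}  σ inj q {()}
minor-injective {suc N} σ inj q {j} {k} eq =
  punchIn-injective q j k (inj (del-injective (σ q) _ _ (avoids j) (avoids k) eq))
  where
  avoids : ∀ j → σ (punchIn q j) ≢ σ q
  avoids j = punchInᵢ≢i q j ∘ inj

minor-surjective : ∀ {N} (σ : Fin (suc N) → Fin (suc N)) → Injective _≡_ _≡_ σ →
  StrictlySurjective _≡_ σ → ∀ q → StrictlySurjective _≡_ (minor σ q)
minor-surjective {zero}  σ inj surj q ()
minor-surjective {suc N} σ inj surj q y with surj (punchIn (σ q) y)
... | x , σx≡ = punchOut q≢x , (begin
  del (σ q) (σ (punchIn q (punchOut q≢x))) ≡⟨ cong (del (σ q) ∘ σ) (punchIn-punchOut q≢x) ⟩
  del (σ q) (σ x)                          ≡⟨ cong (del (σ q)) σx≡ ⟩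
  del (σ q) (punchIn (σ q) y)              ≡⟨ del-punchIn (σ q) y ⟩
  y                                        ∎)
  where
  q≢x : q ≢ x
  q≢x q≡x = punchInᵢ≢i (σ q) y (trans (sym σx≡) (cong σ (sym q≡x)))

minor-comm : ∀ {M} (σ : Fin (suc (suc M)) → Fin (suc (suc M))) → Injective _≡_ _≡_ σ →
  ∀ q j → minor (minor σ (suc q)) zero j ≡ minor (minor σ zero) q j
minor-comm {zero}  σ inj q ()
minor-comm {suc M} σ inj q j =
  del-comm (σ zero) (σ (suc q)) (σ (suc (punchIn q j)))
    (0≢1+n ∘ inj) (0≢1+n ∘ inj) (λ eq → punchInᵢ≢i q j (suc-injective (inj (sym eq))))

sgn-expand : ∀ {N} (σ : Fin (suc N) → Fin (suc N)) → Injective _≡_ _≡_ σ → ∀ q →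
  sgn σ ≡ sgn (minor σ q) + (finParity q + finParity (σ q))
sgn-expand σ inj zero = refl
sgn-expand {suc N} σ inj (suc q) = begin
  sgn σ₀ + finParity a
    ≡⟨ cong (_+ finParity a) (sgn-expand σ₀ (minor-injective σ inj zero) q) ⟩
  sgn (minor σ₀ q) + (finParity q + finParity (del a b)) + finParity a
    ≡⟨ cong (λ z → z + (finParity q + finParity (del a b)) + finParity a)
            (sgn-cong (λ j → sym (minor-comm σ inj q j))) ⟩
  s + (finParity q + finParity (del a b)) + finParity a
    ≡⟨ regroup s (finParity q) (finParity (del a b)) (finParity a) (finParity b) ⟩
  s + (finParity (del a b) + (1ℙ + finParity b + finParity a)) + (1ℙ + finParity q + finParity b)
    ≡⟨ cong (λ z → s + z + (1ℙ + finParity q + finParity b))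
            (sym (+-solveˡ (finParity (del a b)) (del-parity b a (a≢b ∘ sym)))) ⟩
  s + finParity (del b a) + (1ℙ + finParity q + finParity b) ∎
  where
  σ₀ = minor σ zero
  a = σ zero
  b = σ (suc q)
  s = sgn (minor (minor σ (suc q)) zero)
  a≢b : a ≢ b
  a≢b eq with inj eq
  ... | ()
  regroup : ∀ s q d a b → s + (q + d) + a ≡ s + (d + (1ℙ + b + a)) + (1ℙ + q + b)
  regroup = solve-∀ ℙ-ring

minor-∘ : ∀ {N} (σ τ : Fin (suc N) → Fin (suc N)) → Injective _≡_ _≡_ τ →
  ∀ j → minor (σ ∘ τ) zero j ≡ minor σ (τ zero) (minor τ zero j)
minor-∘ {zero}  σ τ inj ()
minor-∘ {suc N} σ τ inj j =
  cong (del (σ (τ zero)) ∘ σ) (sym (punchIn-del (τ zero) (τ (suc j)) (0≢1+n ∘ inj ∘ sym)))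

sgn-∘ : ∀ {N} (σ τ : Fin N → Fin N) → Injective _≡_ _≡_ σ → Injective _≡_ _≡_ τ →
  sgn (σ ∘ τ) ≡ sgn σ + sgn τ
sgn-∘ {zero}  σ τ _ _ = refl
sgn-∘ {suc N} σ τ σ-inj τ-inj = begin
  sgn (minor (σ ∘ τ) zero) + finParity (σ p)
    ≡⟨ cong (_+ finParity (σ p)) (sgn-cong (minor-∘ σ τ τ-inj)) ⟩
  sgn (minor σ p ∘ minor τ zero) + finParity (σ p)
    ≡⟨ cong (_+ finParity (σ p)) (sgn-∘ (minor σ p) (minor τ zero) (minor-injective σ σ-inj p) (minor-injective τ τ-inj zero)) ⟩
  sgn (minor σ p) + sgn (minor τ zero) + finParity (σ p)
    ≡⟨ regroup (sgn (minor σ p)) (sgn (minor τ zero)) (finParity p) (finParity (σ p)) ⟩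
  (sgn (minor σ p) + (finParity p + finParity (σ p))) + (sgn (minor τ zero) + finParity p)
    ≡⟨ cong (_+ sgn τ) (sym (sgn-expand σ σ-inj p)) ⟩
  sgn σ + sgn τ ∎
  where
  p = τ zero
  regroup : ∀ x y q r → x + y + r ≡ (x + (q + r)) + (y + q)
  regroup = solve-∀ ℙ-ring

minor-id : ∀ {N} (j : Fin N) → minor id zero j ≡ j
minor-id {suc N} j = refl

sgn-id : ∀ {N} → sgn {N} id ≡ 0ℙ
sgn-id {zero}  = refl
sgn-id {suc N} = trans (+-identityʳ (sgn (minor {N} id zero))) (trans (sgn-cong (minor-id {N})) (sgn-id {N}))

transpose-matchˡ : ∀ {n} (i j : Fin n) → transpose i j i ≡ j
transpose-matchˡ i j rewrite dec-true (i ≟ i) refl = refl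

transpose-matchʳ : ∀ {n} (i j : Fin n) → transpose i j j ≡ i
transpose-matchʳ i j with j ≟ i
... | yes j≡i = j≡i
... | no  _   rewrite dec-true (j ≟ j) refl = refl

transpose-other : ∀ {n} {i j k : Fin n} → k ≢ i → k ≢ j → transpose i j k ≡ k
transpose-other {i = i} {j} {k} k≢i k≢j
  rewrite dec-false (k ≟ i) k≢i | dec-false (k ≟ j) k≢j = refl

transpose-injective : ∀ {n} (i j : Fin n) → Injective _≡_ _≡_ (transpose i j)
transpose-injective i j {x} {y} eq = begin
  x                                 ≡⟨ sym (transpose-inverse j i) ⟩
  transpose j i (transpose i j x)   ≡⟨ cong (transpose j i) eq ⟩
  transpose j i (transpose i j y)   ≡⟨ transpose-inverse j i ⟩
  y                                 ∎

transpose-conj : ∀ {n} {i j k : Fin n} → i ≢ j → i ≢ k → j ≢ k →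
  ∀ x → transpose i k x ≡ transpose j k (transpose i j (transpose j k x))
transpose-conj {n} {i} {j} {k} i≢j i≢k j≢k x = cases (x ≟ i) (x ≟ j) (x ≟ k)
  where
  Holds : Fin n → Set
  Holds z = transpose i k z ≡ transpose j k (transpose i j (transpose j k z))
  atI : Holds i
  atI = begin
    transpose i k i                                 ≡⟨ transpose-matchˡ i k ⟩
    k                                               ≡⟨ sym (transpose-matchˡ j k) ⟩
    transpose j k j                                 ≡⟨ cong (transpose j k) (sym (transpose-matchˡ i j)) ⟩
    transpose j k (transpose i j i)                 ≡⟨ cong (transpose j k ∘ transpose i j) (sym (transpose-other i≢j i≢k)) ⟩
    transpose j k (transpose i j (transpose j k i)) ∎
  atJ : Holds j
  atJ = begin
    transpose i k j                                 ≡⟨ transpose-other (i≢j ∘ sym) j≢k ⟩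
    j                                               ≡⟨ sym (transpose-matchʳ j k) ⟩
    transpose j k k                                 ≡⟨ cong (transpose j k) (sym (transpose-other (i≢k ∘ sym) (j≢k ∘ sym))) ⟩
    transpose j k (transpose i j k)                 ≡⟨ cong (transpose j k ∘ transpose i j) (sym (transpose-matchˡ j k)) ⟩
    transpose j k (transpose i j (transpose j k j)) ∎
  atK : Holds k
  atK = begin
    transpose i k k                                 ≡⟨ transpose-matchʳ i k ⟩
    i                                               ≡⟨ sym (transpose-other i≢j i≢k) ⟩
    transpose j k i                                 ≡⟨ cong (transpose j k) (sym (transpose-matchʳ i j)) ⟩
    transpose j k (transpose i j j)                 ≡⟨ cong (transpose j k ∘ transpose i j) (sym (transpose-matchʳ j k)) ⟩
    transpose j k (transpose i j (transpose j k k)) ∎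
  cases : Dec (x ≡ i) → Dec (x ≡ j) → Dec (x ≡ k) → Holds x
  cases (yes x≡i) _ _ = subst Holds (sym x≡i) atI
  cases (no _) (yes x≡j) _ = subst Holds (sym x≡j) atJ
  cases (no _) (no _) (yes x≡k) = subst Holds (sym x≡k) atK
  cases (no x≢i) (no x≢j) (no x≢k) = begin
    transpose i k x                                 ≡⟨ transpose-other x≢i x≢k ⟩
    x                                               ≡⟨ sym (transpose-other x≢j x≢k) ⟩
    transpose j k x                                 ≡⟨ cong (transpose j k) (sym (transpose-other x≢i x≢j)) ⟩
    transpose j k (transpose i j x)                 ≡⟨ cong (transpose j k ∘ transpose i j) (sym (transpose-other x≢j x≢k)) ⟩
    transpose j k (transpose i j (transpose j k x)) ∎

minor-transpose01 : ∀ {N} (j : Fin (suc N)) → minor (transpose zero (suc zero)) zero j ≡ j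
minor-transpose01 zero = cong₂ del (transpose-matchˡ zero (suc zero)) (transpose-matchʳ zero (suc zero))
minor-transpose01 {suc N} (suc j) =
  cong₂ del (transpose-matchˡ zero (suc zero)) (transpose-other {i = zero} {suc zero} {suc (suc j)} (λ ()) (λ ()))

-- Every transposition (0 y) is odd: (0 1) directly, and (0 y) as a conjugate of (0 1).
sgn-transpose : ∀ {N} (y : Fin (suc N)) → y ≢ zero → sgn (transpose zero y) ≡ 1ℙ
sgn-transpose zero y≢0 = ⊥-elim (y≢0 refl)
sgn-transpose {suc N} (suc zero) _ = begin
  sgn (minor τ zero) + finParity (τ zero)  ≡⟨ cong₂ _+_ (sgn-cong (minor-transpose01 {N})) (cong finParity (transpose-matchˡ {suc (suc N)} zero (suc zero))) ⟩
  sgn {suc N} id + 1ℙ                      ≡⟨ cong (_+ 1ℙ) (sgn-id {suc N}) ⟩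
  1ℙ                                       ∎
  where
  τ = transpose {suc (suc N)} zero (suc zero)
sgn-transpose {suc (suc N)} (suc (suc y)) _ = begin
  sgn (transpose zero Y)                 ≡⟨ sgn-cong (transpose-conj {i = zero} {one} {Y} (λ ()) (λ ()) 1≢Y) ⟩
  sgn (ρ ∘ (transpose zero one ∘ ρ))     ≡⟨ sgn-∘ ρ (transpose zero one ∘ ρ) ρ-inj (ρ-inj ∘ transpose-injective zero one) ⟩
  sgn ρ + sgn (transpose zero one ∘ ρ)   ≡⟨ cong (sgn ρ +_) (sgn-∘ (transpose zero one) ρ (transpose-injective zero one) ρ-inj) ⟩
  sgn ρ + (sgn (transpose zero one) + sgn ρ) ≡⟨ cong (λ z → sgn ρ + (z + sgn ρ)) (sgn-transpose one (λ ())) ⟩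
  sgn ρ + (1ℙ + sgn ρ)                   ≡⟨ cancel (sgn ρ) ⟩
  1ℙ                                     ∎
  where
  one Y : Fin (suc (suc (suc N)))
  one = suc zero
  Y = suc (suc y)
  1≢Y : one ≢ Y
  1≢Y ()
  ρ = transpose one Y
  ρ-inj = transpose-injective one Y
  cancel : ∀ s → s + (1ℙ + s) ≡ 1ℙ
  cancel = solve-∀ ℙ-ring

iter-shift : ∀ {A : Set} (f : A → A) i x → iter f (suc i) x ≡ iter f i (f x)
iter-shift f zero    x = refl
iter-shift f (suc i) x = cong f (iter-shift f i x)

iter-fixed : ∀ {A : Set} (f : A → A) {x} → f x ≡ x → ∀ i → iter f i x ≡ x
iter-fixed f fx≡x zero    = refl
iter-fixed f fx≡x (suc i) = trans (cong f (iter-fixed f fx≡x i)) fx≡x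

minor-fixed : ∀ {N} (σ : Fin (suc N) → Fin (suc N)) → Injective _≡_ _≡_ σ → σ zero ≡ zero →
  ∀ j → suc (minor σ zero j) ≡ σ (suc j)
minor-fixed {zero}  σ inj fix ()
minor-fixed {suc N} σ inj fix j =
  subst (λ z → punchIn z (del (σ zero) (σ (suc j))) ≡ σ (suc j)) fix
        (punchIn-del (σ zero) (σ (suc j)) (0≢1+n ∘ inj ∘ sym))

iter-minor-fixed : ∀ {N} (σ : Fin (suc N) → Fin (suc N)) → Injective _≡_ _≡_ σ → σ zero ≡ zero →
  ∀ i j → suc (iter (minor σ zero) i j) ≡ iter σ i (suc j)
iter-minor-fixed σ inj fix zero    j = refl
iter-minor-fixed σ inj fix (suc i) j =
  trans (minor-fixed σ inj fix _) (cong σ (iter-minor-fixed σ inj fix i j))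

sgn-fixed : ∀ {N} (σ : Fin (suc N) → Fin (suc N)) → σ zero ≡ zero → sgn σ ≡ sgn (minor σ zero)
sgn-fixed σ fix = trans (cong (λ z → sgn (minor σ zero) + finParity z) fix) (+-identityʳ _)

transpose-preserves : ∀ {A : Set} {n} (f : Fin n → A) {i j} → f i ≡ f j →
  ∀ x → f (transpose i j x) ≡ f x
transpose-preserves f {i} {j} fi≡fj x = cases (x ≟ i) (x ≟ j)
  where
  cases : Dec (x ≡ i) → Dec (x ≡ j) → f (transpose i j x) ≡ f x
  cases (yes x≡i) _ = subst (λ z → f (transpose i j z) ≡ f z) (sym x≡i)
                            (trans (cong f (transpose-matchˡ i j)) (sym fi≡fj))
  cases (no _) (yes x≡j) = subst (λ z → f (transpose i j z) ≡ f z) (sym x≡j)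
                                 (trans (cong f (transpose-matchʳ i j)) fi≡fj)
  cases (no x≢i) (no x≢j) = cong f (transpose-other x≢i x≢j)

-- σ is a permutation of A whose orbits are exactly the fibres of the
-- surjective labelling f : A → Fin k; so σ has exactly k cycles.
record OrbitLabelling {A : Set} {k : ℕ} (σ : A → A) (f : A → Fin k) : Set where
  field
    injective  : Injective _≡_ _≡_ σ
    surjective : StrictlySurjective _≡_ σ
    invariant  : ∀ x → f (σ x) ≡ f x
    transitive : ∀ x y → f x ≡ f y → ∃ λ i → iter σ i x ≡ y
    onto       : ∀ ℓ → ∃ λ x → f x ≡ ℓ

-- A fixed point is an orbit on its own: deleting it leaves a permutation of the
-- remaining points whose orbits carry the remaining k labels.
removeFixedPoint : ∀ {N k} {σ : Fin (suc N) → Fin (suc N)} {f : Fin (suc N) → Fin (suc k)} →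
  OrbitLabelling σ f → σ zero ≡ zero → ∃ λ (g : Fin N → Fin k) → OrbitLabelling (minor σ zero) g
removeFixedPoint {N} {k} {σ} {f} O fix = g , record
  { injective  = minor-injective σ injective zero
  ; surjective = minor-surjective σ injective surjective zero
  ; invariant  = λ j → punchOut-cong ℓ (trans (cong f (minor-fixed σ injective fix j)) (invariant (suc j)))
  ; transitive = transitive′
  ; onto       = onto′
  }
  where
  open OrbitLabelling O
  ℓ = f zero
  alone : ∀ x → f x ≡ ℓ → x ≡ zero
  alone x fx≡ℓ with transitive zero x (sym fx≡ℓ)
  ... | i , reach = trans (sym reach) (iter-fixed σ fix i)
  ℓ≢ : ∀ j → ℓ ≢ f (suc j)
  ℓ≢ j eq with alone (suc j) (sym eq)
  ... | ()
  g : Fin N → Fin k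
  g j = punchOut (ℓ≢ j)
  transitive′ : ∀ x y → g x ≡ g y → ∃ λ i → iter (minor σ zero) i x ≡ y
  transitive′ x y gx≡gy with transitive (suc x) (suc y) (punchOut-injective (ℓ≢ x) (ℓ≢ y) gx≡gy)
  ... | i , reach = i , suc-injective (trans (iter-minor-fixed σ injective fix i x) reach)
  onto′ : ∀ ℓ′ → ∃ λ x → g x ≡ ℓ′
  onto′ ℓ′ with onto (punchIn ℓ ℓ′)
  ... | zero  , fx≡ = ⊥-elim (punchInᵢ≢i ℓ ℓ′ (sym fx≡))
  ... | suc x , fx≡ = x , trans (punchOut-cong ℓ fx≡) (punchOut-punchIn ℓ)

nonzero : ∀ {n} (y : Fin (suc n)) → y ≢ zero → ∃ λ y′ → suc y′ ≡ y
nonzero zero    y≢0 = ⊥-elim (y≢0 refl)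
nonzero (suc y) _   = y , refl

-- If σ moves 0 and σ y = 0, then σ′ = σ ∘ (0 y) fixes 0 and has the same
-- orbits as σ on the other points (the visit to 0 is skipped): cutting 0 out
-- of its cycle changes the sign by one and keeps all k labels.
module SplitOffZero {N k} {σ : Fin (suc N) → Fin (suc N)} {f : Fin (suc N) → Fin k}
                    (O : OrbitLabelling σ f) {y : Fin (suc N)} (σy≡0 : σ y ≡ zero)
                    (moved : σ zero ≢ zero) where
  open OrbitLabelling O

  τ = transpose zero y
  σ′ = σ ∘ τ

  y≢0 : y ≢ zero
  y≢0 y≡0 = moved (trans (cong σ (sym y≡0)) σy≡0)

  σ′-injective : Injective _≡_ _≡_ σ′
  σ′-injective = transpose-injective zero y ∘ injective

  σ′-surjective : StrictlySurjective _≡_ σ′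
  σ′-surjective z with surjective z
  ... | x , σx≡z = transpose y zero x , trans (cong σ (transpose-inverse zero y)) σx≡z

  σ′-fixes-0 : σ′ zero ≡ zero
  σ′-fixes-0 = trans (cong σ (transpose-matchˡ zero y)) σy≡0

  sgn-split : sgn σ ≡ 1ℙ + sgn (minor σ′ zero)
  sgn-split = +-solveˡ 1ℙ (begin
    sgn σ + 1ℙ                ≡⟨ cong (sgn σ +_) (sym (sgn-transpose y y≢0)) ⟩
    sgn σ + sgn τ             ≡⟨ sym (sgn-∘ σ τ injective (transpose-injective zero y)) ⟩
    sgn σ′                    ≡⟨ sgn-fixed σ′ σ′-fixes-0 ⟩
    sgn (minor σ′ zero)       ∎)

  f0≡fy : f zero ≡ f y
  f0≡fy = trans (sym (cong f σy≡0)) (invariant y)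

  τ-preserves : ∀ x → f (τ x) ≡ f x
  τ-preserves = transpose-preserves f f0≡fy

  reroute : ∀ i {c d} → c ≢ zero → d ≢ zero → iter σ i c ≡ d → ∃ λ j → iter σ′ j c ≡ d
  reroute zero    c≢0 d≢0 reach = zero , reach
  reroute (suc i) {c} c≢0 d≢0 reach with σ c ≟ zero
  reroute (suc i) {c} c≢0 d≢0 reach | no σc≢0
    with reroute i σc≢0 d≢0 (trans (sym (iter-shift σ i c)) reach)
  ... | j , reach′ = suc j , trans (iter-shift σ′ j c) (trans (cong (iter σ′ j) σ′c≡σc) reach′)
    where
    σ′c≡σc : σ′ c ≡ σ c
    σ′c≡σc = cong σ (transpose-other c≢0 (λ c≡y → σc≢0 (trans (cong σ c≡y) σy≡0)))
  reroute (suc zero) c≢0 d≢0 reach | yes σc≡0 = ⊥-elim (d≢0 (trans (sym reach) σc≡0))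
  reroute (suc (suc i)) {c} c≢0 d≢0 reach | yes σc≡0
    with reroute i moved d≢0 (begin
      iter σ i (σ zero)           ≡⟨ cong (iter σ i ∘ σ) (sym σc≡0) ⟩
      iter σ i (σ (σ c))          ≡⟨ sym (iter-shift σ i (σ c)) ⟩
      iter σ (suc i) (σ c)        ≡⟨ sym (iter-shift σ (suc i) c) ⟩
      iter σ (suc (suc i)) c      ≡⟨ reach ⟩
      _                           ∎)
  ... | j , reach′ = suc j , trans (iter-shift σ′ j c) (trans (cong (iter σ′ j) σ′c≡σ0) reach′)
    where
    σ′c≡σ0 : σ′ c ≡ σ zero
    σ′c≡σ0 = cong σ (trans (cong τ (injective (trans σc≡0 (sym σy≡0)))) (transpose-matchʳ zero y))

  orbits : OrbitLabelling (minor σ′ zero) (f ∘ suc)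
  orbits = record
    { injective  = minor-injective σ′ σ′-injective zero
    ; surjective = minor-surjective σ′ σ′-injective σ′-surjective zero
    ; invariant  = λ j → begin
        f (suc (minor σ′ zero j)) ≡⟨ cong f (minor-fixed σ′ σ′-injective σ′-fixes-0 j) ⟩
        f (σ (τ (suc j)))         ≡⟨ invariant (τ (suc j)) ⟩
        f (τ (suc j))             ≡⟨ τ-preserves (suc j) ⟩
        f (suc j)                 ∎
    ; transitive = transitive′
    ; onto       = onto′
    }
    where
    transitive′ : ∀ a b → f (suc a) ≡ f (suc b) → ∃ λ i → iter (minor σ′ zero) i a ≡ b
    transitive′ a b eq with transitive (suc a) (suc b) eq
    ... | i , reach with reroute i (λ ()) (λ ()) reach
    ...   | j , reach′ = j , suc-injective (trans (iter-minor-fixed σ′ σ′-injective σ′-fixes-0 j a) reach′)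
    onto′ : ∀ ℓ → ∃ λ x → f (suc x) ≡ ℓ
    onto′ ℓ with onto ℓ
    ... | suc x , fx≡ℓ = x , fx≡ℓ
    ... | zero  , f0≡ℓ with nonzero y y≢0
    ...   | y′ , suc-y′≡y = y′ , trans (cong f suc-y′≡y) (trans (sym f0≡fy) f0≡ℓ)

parity-suc : ∀ n → parity (suc n) ≡ 1ℙ + parity n
parity-suc n = +-homo-+ 1 n

-- A permutation of N points with k cycles has sign N - k (mod 2).
-- Induction on N: a fixed point is deleted together with its label, and
-- otherwise the cycle through 0 is cut by a transposition.
orbitParity : ∀ {N k} {σ : Fin N → Fin N} {f : Fin N → Fin k} →
  OrbitLabelling σ f → sgn σ + parity k ≡ parity N
orbitParity {zero}  {zero}  O = refl
orbitParity {zero}  {suc k} O with OrbitLabelling.onto O zero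
... | () , _
orbitParity {suc N} {zero}  {f = f} O with f zero
... | ()
orbitParity {suc N} {suc k} {σ} O with σ zero ≟ zero
... | yes fix with removeFixedPoint O fix
...   | g , O′ = begin
  sgn σ + parity (suc k)                  ≡⟨ cong₂ _+_ (sgn-fixed σ fix) (parity-suc k) ⟩
  sgn (minor σ zero) + (1ℙ + parity k)    ≡⟨ swap (sgn (minor σ zero)) (parity k) ⟩
  1ℙ + (sgn (minor σ zero) + parity k)    ≡⟨ cong (1ℙ +_) (orbitParity O′) ⟩
  1ℙ + parity N                           ≡⟨ sym (parity-suc N) ⟩
  parity (suc N)                          ∎
  where
  swap : ∀ x p → x + (1ℙ + p) ≡ 1ℙ + (x + p)
  swap = solve-∀ ℙ-ring
orbitParity {suc N} {suc k} {σ} O | no moved with OrbitLabelling.surjective O zero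
... | y , σy≡0 = begin
  sgn σ + parity (suc k)                        ≡⟨ cong (_+ parity (suc k)) sgn-split ⟩
  1ℙ + sgn (minor σ′ zero) + parity (suc k)     ≡⟨ +-assoc 1ℙ (sgn (minor σ′ zero)) (parity (suc k)) ⟩
  1ℙ + (sgn (minor σ′ zero) + parity (suc k))   ≡⟨ cong (1ℙ +_) (orbitParity orbits) ⟩
  1ℙ + parity N                                 ≡⟨ sym (parity-suc N) ⟩
  parity (suc N)                                ∎
  where open SplitOffZero O σy≡0 moved

conj : ∀ {A : Set} {N} → A ↔ Fin N → (A → A) → Fin N → Fin N
conj e ω = to ∘ ω ∘ from
  where open Inverse e

module _ {A : Set} {N} (e : A ↔ Fin N) where
  open Inverse e

  conj-∘ : ∀ (ω ω′ : A → A) x → conj e (ω ∘ ω′) x ≡ conj e ω (conj e ω′ x)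
  conj-∘ ω ω′ x = cong (to ∘ ω) (sym (strictlyInverseʳ (ω′ (from x))))

  iter-conj : ∀ (ω : A → A) i x → iter (conj e ω) i x ≡ to (iter ω i (from x))
  iter-conj ω zero    x = sym (strictlyInverseˡ x)
  iter-conj ω (suc i) x = begin
    to (ω (from (iter (conj e ω) i x)))   ≡⟨ cong (to ∘ ω ∘ from) (iter-conj ω i x) ⟩
    to (ω (from (to (iter ω i (from x)))))  ≡⟨ cong (to ∘ ω) (strictlyInverseʳ _) ⟩
    to (ω (iter ω i (from x)))             ∎

  conj-orbitLabelling : ∀ {k} {ω : A → A} {f : A → Fin k} →
    OrbitLabelling ω f → OrbitLabelling (conj e ω) (f ∘ from)
  conj-orbitLabelling {ω = ω} {f} O = record
    { injective  = λ {x} {y} eq → begin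
        x                ≡⟨ sym (strictlyInverseˡ x) ⟩
        to (from x)      ≡⟨ cong to (O.injective (Injection.injective (↔⇒↣ e) eq)) ⟩
        to (from y)      ≡⟨ strictlyInverseˡ y ⟩
        y                ∎
    ; surjective = λ z → let (a , ωa≡) = O.surjective (from z) in
        to a , trans (cong (to ∘ ω) (strictlyInverseʳ a)) (trans (cong to ωa≡) (strictlyInverseˡ z))
    ; invariant  = λ x → trans (cong f (strictlyInverseʳ _)) (O.invariant (from x))
    ; transitive = λ x y eq → let (i , reach) = O.transitive (from x) (from y) eq in
        i , trans (iter-conj ω i x) (trans (cong to reach) (strictlyInverseˡ y))
    ; onto       = λ ℓ → let (a , fa≡ℓ) = O.onto ℓ in
        to a , trans (cong f (strictlyInverseʳ a)) fa≡ℓ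
    }
    where module O = OrbitLabelling O

-- If ρ, κ and ρ ∘ κ are permutations of an N-element set with a, b and c
-- cycles respectively, then N ≡ a + b + c (mod 2): the sign is multiplicative
-- and a permutation with k cycles has sign N - k.
orbitCount-product : ∀ {A : Set} {N a b c} (e : A ↔ Fin N) {ρ κ : A → A}
  {f : A → Fin a} {g : A → Fin b} {h : A → Fin c} →
  OrbitLabelling ρ f → OrbitLabelling κ g → OrbitLabelling (ρ ∘ κ) h →
  parity N ≡ parity a + parity b + parity c
orbitCount-product {A} {N} {a} {b} {c} e {ρ} {κ} Oρ Oκ Oρκ = begin
  parity N                                            ≡⟨ sym (orbitParity (conj-orbitLabelling e Oρκ)) ⟩
  sgn (conj e (ρ ∘ κ)) + parity c                     ≡⟨ cong (_+ parity c) sgn-product ⟩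
  sgn (conj e ρ) + sgn (conj e κ) + parity c          ≡⟨ cong₂ (λ u v → u + v + parity c) (sgn-cycles Oρ) (sgn-cycles Oκ) ⟩
  (parity a + parity N) + (parity b + parity N) + parity c ≡⟨ cancel (parity a) (parity b) (parity c) (parity N) ⟩
  parity a + parity b + parity c                      ∎
  where
  sgn-cycles : ∀ {k} {ω : A → A} {f : A → Fin k} → OrbitLabelling ω f → sgn (conj e ω) ≡ parity k + parity N
  sgn-cycles {k} O = +-solveˡ (parity k) (orbitParity (conj-orbitLabelling e O))
  sgn-product : sgn (conj e (ρ ∘ κ)) ≡ sgn (conj e ρ) + sgn (conj e κ)
  sgn-product = trans (sgn-cong (conj-∘ e ρ κ))
    (sgn-∘ (conj e ρ) (conj e κ) (OrbitLabelling.injective (conj-orbitLabelling e Oρ))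
                                 (OrbitLabelling.injective (conj-orbitLabelling e Oκ)))
  cancel : ∀ a b c n → (a + n) + (b + n) + c ≡ a + b + c
  cancel = solve-∀ ℙ-ring

Σ-Fin-suc : ∀ {k} (B : Fin (suc k) → Set) → Σ (Fin (suc k)) B ↔ (B zero ⊎ Σ (Fin k) (B ∘ suc))
Σ-Fin-suc B = mk↔ₛ′ split join split-join join-split
  where
  split : Σ _ B → B zero ⊎ Σ _ (B ∘ suc)
  split (zero  , x) = inj₁ x
  split (suc i , x) = inj₂ (i , x)
  join : B zero ⊎ Σ _ (B ∘ suc) → Σ _ B
  join (inj₁ x)       = zero , x
  join (inj₂ (i , x)) = suc i , x
  split-join : ∀ y → split (join y) ≡ y
  split-join (inj₁ x)       = refl
  split-join (inj₂ (i , x)) = refl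
  join-split : ∀ x → join (split x) ≡ x
  join-split (zero  , x) = refl
  join-split (suc i , x) = refl

T↔Fin : ∀ b → T b ↔ Fin (if b then 1 else 0)
T↔Fin true  = ↔-sym 1↔⊤
T↔Fin false = ↔-sym 0↔⊥

selected↔ : ∀ {n k} (b : Fin n → Bool) (h : Fin k → Fin n) →
  Σ (Fin k) (λ j → T (b (h j))) ↔ Fin (sum (map (λ j → if b j then 1 else 0) (tabulate h)))
selected↔ {k = zero}  b h = mk↔ₛ′ (λ ()) (λ ()) (λ ()) (λ ())
selected↔ {k = suc k} b h =
  ↔-trans (Σ-Fin-suc _) (↔-trans (T↔Fin (b (h zero)) ⊎-↔ selected↔ b (h ∘ suc)) (↔-sym +↔⊎))

transposeArray : ∀ {m n} → PArray m n → PArray n m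
transposeArray H j i = H i j

Cell-transpose : ∀ {m n} (H : PArray m n) → Cell H ↔ Cell (transposeArray H)
Cell-transpose H = mk↔ₛ′ (λ ((i , j) , c) → (j , i) , c) (λ ((j , i) , c) → (i , j) , c)
                         (λ _ → refl) (λ _ → refl)

rowCells↔ : ∀ {m n} (H : PArray m n) i → Σ (Fin n) (λ j → T (is-just (H i j))) ↔ Fin (rowCount H i)
rowCells↔ H i = selected↔ (λ j → is-just (H i j)) id

cells↔ : ∀ {m n s} (H : PArray m n) → (∀ i → rowCount H i ≡ s) → Cell H ↔ Fin (m * s)
cells↔ {m} {n} {s} H rows = ↔-trans byRows (↔-trans (Σ-↔ ↔-refl rowCells) (↔-sym *↔×))
  where
  byRows : Cell H ↔ Σ (Fin m) λ i → Σ (Fin n) λ j → T (is-just (H i j))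
  byRows = mk↔ₛ′ (λ ((i , j) , c) → i , j , c) (λ (i , j , c) → (i , j) , c) (λ _ → refl) (λ _ → refl)
  rowCells : ∀ {i} → Σ (Fin n) (λ j → T (is-just (H i j))) ↔ Fin s
  rowCells {i} = subst (λ c → _ ↔ Fin c) (rows i) (rowCells↔ H i)

Fin-↔⇒≡ : ∀ {a b} → Fin a ↔ Fin b → a ≡ b
Fin-↔⇒≡ e = ≤-antisym (injective⇒≤ (Injection.injective (↔⇒↣ e)))
                      (injective⇒≤ (Injection.injective (↔⇒↣ (↔-sym e))))

rowWitness : ∀ {m n s} (H : PArray m n) → (∀ i → rowCount H i ≡ s) → 1 ≤ s →
  ∀ i → ∃ λ (c : Cell H) → rowOf c ≡ i
rowWitness H rows s≥1 i with Inverse.from (rowCells↔ H i) (subst Fin (sym (rows i)) (fromℕ< s≥1))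
... | j , filled = ((i , j) , filled) , refl

orderingOrbits : ∀ {A : Set} {k} {ω : A → A} {f : A → Fin k} → Bijective _≡_ _≡_ ω →
  (∀ c → f (ω c) ≡ f c) → (∀ c d → f c ≡ f d → ∃ λ i → iter ω i c ≡ d) →
  (∀ ℓ → ∃ λ c → f c ≡ ℓ) → OrbitLabelling ω f
orderingOrbits (inj , surj) inv cycles inhabited = record
  { injective  = inj
  ; surjective = surjective⇒strictlySurjective surj
  ; invariant  = inv
  ; transitive = cycles
  ; onto       = inhabited
  }

even⇒2∣ : ∀ x → parity x ≡ 0ℙ → 2 ∣ x
even⇒2∣ zero          _    = 2 ∣0
even⇒2∣ (suc (suc x)) even = ∣m∣n⇒∣m+n (∣-refl {2}) (even⇒2∣ x even)

odd⇒2∤ : ∀ x → parity x ≡ 1ℙ → ¬ 2 ∣ x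
odd⇒2∤ x odd (divides q refl) with trans (sym odd) (trans (*-homo-* q 2) (*-zeroʳ (parity q)))
... | ()

parityCases : ∀ pm pn ps pt → pm ℙ.* ps ≡ pm + pn + 1ℙ → pn ℙ.* pt ≡ pm + pn + 1ℙ →
  (pm ≡ 1ℙ × pn ≡ 1ℙ × ps ≡ 1ℙ × pt ≡ 1ℙ) ⊎ (pm ≡ 1ℙ × pn ≡ 0ℙ × ps ≡ 0ℙ) ⊎ (pm ≡ 0ℙ × pn ≡ 1ℙ × pt ≡ 0ℙ)
parityCases 0ℙ 0ℙ ps pt () _
parityCases 1ℙ 1ℙ ps pt hs ht = inj₁ (refl , refl , hs , ht)
parityCases 1ℙ 0ℙ ps pt hs _  = inj₂ (inj₁ (refl , refl , hs))
parityCases 0ℙ 1ℙ ps pt _  ht = inj₂ (inj₂ (refl , refl , ht))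

admissibleShape : ∀ m n s t → parity (m * s) ≡ parity m + parity n + 1ℙ → m * s ≡ n * t →
    ((¬ 2 ∣ m) × (¬ 2 ∣ n) × (¬ 2 ∣ s) × (¬ 2 ∣ t))
    ⊎ ((¬ 2 ∣ m) × (2 ∣ n) × (2 ∣ s))
    ⊎ ((2 ∣ m) × (¬ 2 ∣ n) × (2 ∣ t))
admissibleShape m n s t cycles ms≡nt
  with parityCases (parity m) (parity n) (parity s) (parity t)
         (trans (sym (*-homo-* m s)) cycles)
         (trans (sym (*-homo-* n t)) (trans (cong parity (sym ms≡nt)) cycles))
... | inj₁ (m-odd , n-odd , s-odd , t-odd) =
  inj₁ (odd⇒2∤ m m-odd , odd⇒2∤ n n-odd , odd⇒2∤ s s-odd , odd⇒2∤ t t-odd)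
... | inj₂ (inj₁ (m-odd , n-even , s-even)) =
  inj₂ (inj₁ (odd⇒2∤ m m-odd , even⇒2∣ n n-even , even⇒2∣ s s-even))
... | inj₂ (inj₂ (m-even , n-odd , t-even)) =
  inj₂ (inj₂ (even⇒2∣ m m-even , odd⇒2∤ n n-odd , even⇒2∣ t t-even))

mainTheorem1 : (m n s t : ℕ) → 1 ≤ m → 1 ≤ n → 1 ≤ s → 1 ≤ t →
    (H : PArray m n) → IsHeffter m n s t H →
    (Σ (Cell H → Cell H) λ ωr → Σ (Cell H → Cell H) λ ωc →
      IsRowOrdering H ωr × IsColOrdering H ωc × Compatible H ωr ωc) →
    ((¬ 2 ∣ m) × (¬ 2 ∣ n) × (¬ 2 ∣ s) × (¬ 2 ∣ t))
    ⊎ ((¬ 2 ∣ m) × (2 ∣ n) × (2 ∣ s))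
    ⊎ ((2 ∣ m) × (¬ 2 ∣ n) × (2 ∣ t))
mainTheorem1 m n s t m≥1 _ s≥1 t≥1 H heffter
  (ωr , ωc , (ωr-bij , ωr-rows , ωr-cycles) , (ωc-bij , ωc-cols , ωc-cycles) , compatible) =
  admissibleShape m n s t (orbitCount-product byRows rowOrbits colOrbits productOrbit) cellCount
  where
  open IsHeffter heffter
  byRows : Cell H ↔ Fin (m * s)
  byRows = cells↔ H rowFilled
  cellCount : m * s ≡ n * t
  cellCount = Fin-↔⇒≡ (↔-trans (↔-sym byRows)
                         (↔-trans (Cell-transpose H) (cells↔ (transposeArray H) colFilled)))
  colWitness : ∀ j → ∃ λ (c : Cell H) → colOf c ≡ j
  colWitness j with rowWitness (transposeArray H) colFilled t≥1 j
  ... | c , row≡j = Inverse.from (Cell-transpose H) c , row≡j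
  rowOrbits : OrbitLabelling ωr rowOf
  rowOrbits = orderingOrbits ωr-bij ωr-rows ωr-cycles (rowWitness H rowFilled s≥1)
  colOrbits : OrbitLabelling ωc colOf
  colOrbits = orderingOrbits ωc-bij ωc-cols ωc-cycles colWitness
  productOrbit : OrbitLabelling {k = 1} (ωr ∘ ωc) (λ _ → zero)
  productOrbit =
    orderingOrbits (bijective _≡_ _≡_ _≡_ ωc-bij ωr-bij) (λ _ → refl) (λ c d _ → compatible c d)
      λ { zero → map₂ (λ _ → refl) (rowWitness H rowFilled s≥1 (fromℕ< m≥1)) ; (suc ()) }
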